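{- Let $n\geq 3$ be a natural number. In the basic Fraenkel model $\mathcal{V}_{F_0}$, with $A$ its set of atoms, there is no injection from $C_n(A)$ into $\textup{Part}(A)$, i.e. $\mathcal{V}_{F_0}\vDash |C_n(A)|\nleq|\textup{Part}(A)|$.
   Context: The basic Fraenkel model $\mathcal{V}_{F_0}$ is the permutation model of ZFA (set theory with atoms) determined by a countably infinite set $A$ of atoms, the group $\mathcal{G}$ of all permutations of $A$ (extended to the universe $V$ of sets over $A$ in the usual way, fixing pure sets), and the normal ideal of finite subsets of $A$: it consists of those $x$ (hereditarily) having a finite support $E\subseteq A$, meaning every $\pi\in\mathcal{G}$ fixing $E$ pointwise satisfies $\pi x=x$. For a set $X$, $\textup{Part}(X)$ is the set of all partitions of $X$, and $C_n(X)$ is the set of permutations of $X$ that are cycles with exactly $n$ non-fixed points (i.e. cyclic permutations $(a_0;a_1;\ldots;a_{n-1})$ with $a_0\mapsto a_1\mapsto\cdots\mapsto a_{n-1}\mapsto a_0$ and all other points fixed). -}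

module Defs where

open import Data.Nat using (ℕ; suc; _∸_; _<_)
open import Data.List using (List)
open import Data.List.Membership.Propositional using (_∈_)
open import Data.Product using (Σ; ∃; _×_)
open import Relation.Binary.PropositionalEquality using (_≡_)
open import Relation.Nullary using (¬_)
open import Function.Bundles using (_↔_; Inverse)

-- The atoms of the basic Fraenkel model: a countably infinite set, taken to be ℕ.
Atom : Set
Atom = ℕ

Subset : Set₁
Subset = Atom → Set

_≐_ : Subset → Subset → Set
B ≐ C = ∀ a → (B a → C a) × (C a → B a)

record Partition : Set₁ where
  field
    Block     : Subset → Set
    block-ext : ∀ {B C} → B ≐ C → Block B → Block C
    nonempty  : ∀ B → Block B → ∃ λ a → B a
    disjoint  : ∀ B C → Block B → Block C → ∀ a → B a → C a → B ≐ C
    cover     : ∀ a → Σ Subset λ B → Block B × B a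
open Partition public

_≈P_ : Partition → Partition → Set₁
P ≈P Q = ∀ B → (Block P B → Block Q B) × (Block Q B → Block P B)

record Cycle (n : ℕ) : Set where
  field
    σ       : Atom → Atom
    pts     : ℕ → Atom
    pts-inj : ∀ i j → i < n → j < n → pts i ≡ pts j → i ≡ j
    step    : ∀ i → suc i < n → σ (pts i) ≡ pts (suc i)
    wrap    : σ (pts (n ∸ 1)) ≡ pts 0
    fixed   : ∀ a → (∀ i → i < n → ¬ pts i ≡ a) → σ a ≡ a
open Cycle public

_≈C_ : ∀ {n} → Cycle n → Cycle n → Set
c ≈C d = ∀ a → σ c a ≡ σ d a

Perm : Set
Perm = Atom ↔ Atom

Fixes : Perm → List Atom → Set
Fixes π E = ∀ e → e ∈ E → Inverse.to π e ≡ e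

-- A function f : C_n(A) → Part(A) (in the ambient universe) is an element of the
-- basic Fraenkel model iff it has a finite support E: for all π fixing E pointwise,
-- π f = f, i.e. f (π c π⁻¹) = π · (f c).  Here d = π c π⁻¹ means
-- σ d = π ∘ σ c ∘ π⁻¹, and C is a block of π·P iff π⁻¹[C] = {a | π a ∈ C} is a block of P.
FinitelySupported : ∀ {n} → (Cycle n → Partition) → Set₁
FinitelySupported {n} f =
  Σ (List Atom) λ E → ∀ (π : Perm) → Fixes π E →
    ∀ (c d : Cycle n) →
      (∀ a → σ d a ≡ Inverse.to π (σ c (Inverse.from π a))) →
      ∀ (C : Subset) →
        (Block (f d) C → Block (f c) (λ a → C (Inverse.to π a))) ×
        (Block (f c) (λ a → C (Inverse.to π a)) → Block (f d) C)

WellDefined : ∀ {n} → (Cycle n → Partition) → Set₁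
WellDefined {n} f = ∀ (c d : Cycle n) → c ≈C d → f c ≈P f d

Injective : ∀ {n} → (Cycle n → Partition) → Set₁
Injective {n} f = ∀ (c d : Cycle n) → f c ≈P f d → c ≈C d

InjectionInModel : ℕ → Set₁
InjectionInModel n =
  Σ (Cycle n → Partition) λ f → WellDefined f × Injective f × FinitelySupported f

-- Let f be an injection C_n(A) → Part(A) with finite support E, and let c be an n-cycle
-- (p ; σp ; …) on atoms outside E.  Every permutation fixing E and commuting with c fixes
-- f c, so the partition P = f c is invariant under c; and whenever a transposition
-- τ = (p q) with q ∉ E maps P to itself, f (τ c τ) = τ · P = P = f c forces τ c τ = c,
-- which is impossible for n ≥ 3.  Such a τ always exists: if the block of p contains some
-- q ∉ E, swapping p and q fixes P; otherwise, by c-invariance, {p} and {σp} are both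
-- singleton blocks, and swapping p and σp fixes P.
module Submission where

open import Defs
open import Data.Nat using (ℕ; zero; suc; _+_; _∸_; _≤_; _<_; s≤s; s≤s⁻¹; _≤?_; _≟_)
open import Data.Nat.Properties
  using (+-cancelˡ-≡; +-monoʳ-<; <-trans; <-≤-trans; <⇒≤; <⇒≢; ≰⇒>; m≤n⇒m<n∨m≡n;
         m≤m+n; m+[n∸m]≡n; n<1+n)
open import Data.List using (List)
open import Data.List.Extrema.Nat using (max; xs≤max)
open import Data.List.Membership.Propositional using (_∉_)
open import Data.List.Membership.DecPropositional _≟_ using (_∈?_)
import Data.List.Relation.Unary.All as All
open import Data.Product using (Σ; _×_; _,_; proj₁; proj₂)
open import Data.Sum using (inj₁; inj₂)
open import Data.Empty using (⊥; ⊥-elim)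
open import Function using (_∘_; id)
open import Function.Bundles using (Inverse; Injection; _↔_; mk↔ₛ′)
open import Function.Properties.Inverse using (↔⇒↣)
open import Function.Construct.Composition using (_↔-∘_)
open import Function.Construct.Identity using (↔-id)
open import Function.Construct.Symmetry using (↔-sym)
open import Relation.Nullary using (¬_; yes; no; contradiction)
open import Relation.Binary.Core using (Rel; _Preserves_⟶_)
open import Relation.Binary.Definitions using (DecidableEquality)
open import Relation.Binary.Structures using (IsEquivalence)
open import Relation.Binary.PropositionalEquality
  using (_≡_; _≢_; ≢-sym; refl; sym; trans; cong; subst; subst₂; module ≡-Reasoning)

open Inverse using (to; from; strictlyInverseˡ; strictlyInverseʳ)

module Transposition {a} {A : Set a} (_≟ᴬ_ : DecidableEquality A) where

  transpose : A → A → A → A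
  transpose p q x with x ≟ᴬ p
  ... | yes _ = q
  ... | no _ with x ≟ᴬ q
  ...   | yes _ = p
  ...   | no _  = x

  transpose-first : ∀ p q → transpose p q p ≡ q
  transpose-first p q with p ≟ᴬ p
  ... | yes _   = refl
  ... | no p≢p  = contradiction refl p≢p

  transpose-second : ∀ p q → transpose p q q ≡ p
  transpose-second p q with q ≟ᴬ p
  ... | yes q≡p = q≡p
  ... | no _ with q ≟ᴬ q
  ...   | yes _  = refl
  ...   | no q≢q = contradiction refl q≢q

  transpose-other : ∀ {p q x} → x ≢ p → x ≢ q → transpose p q x ≡ x
  transpose-other {p} {q} {x} x≢p x≢q with x ≟ᴬ p
  ... | yes x≡p = contradiction x≡p x≢p
  ... | no _ with x ≟ᴬ q
  ...   | yes x≡q = contradiction x≡q x≢q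
  ...   | no _    = refl

  data TransposeView (p q x : A) : Set a where
    first  : x ≡ p → transpose p q x ≡ q → TransposeView p q x
    second : x ≡ q → transpose p q x ≡ p → TransposeView p q x
    other  : x ≢ p → x ≢ q → transpose p q x ≡ x → TransposeView p q x

  transposeView : ∀ p q x → TransposeView p q x
  transposeView p q x with x ≟ᴬ p | x ≟ᴬ q
  ... | yes refl | _       = first refl (transpose-first p q)
  ... | no _     | yes refl = second refl (transpose-second p q)
  ... | no x≢p   | no x≢q  = other x≢p x≢q (transpose-other x≢p x≢q)

  transpose-involutive : ∀ p q x → transpose p q (transpose p q x) ≡ x
  transpose-involutive p q x with transposeView p q x
  ... | first refl τx      = trans (cong (transpose p q) τx) (transpose-second p q)
  ... | second refl τx     = trans (cong (transpose p q) τx) (transpose-first p q)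
  ... | other _ _ τx       = trans (cong (transpose p q) τx) τx

  transposition : A → A → A ↔ A
  transposition p q =
    mk↔ₛ′ (transpose p q) (transpose p q) (transpose-involutive p q) (transpose-involutive p q)

  module _ {ℓ} {_∼_ : Rel A ℓ} (∼-isEquivalence : IsEquivalence _∼_) where
    open IsEquivalence ∼-isEquivalence renaming (refl to ∼-refl; sym to ∼-sym)

    private
      along : ∀ {x y u v} → x ≡ u → y ≡ v → u ∼ v → x ∼ y
      along refl refl u∼v = u∼v

    transpose-preserves :
      ∀ {p q} → (∀ {z} → z ≢ p → z ≢ q → (p ∼ z → q ∼ z) × (q ∼ z → p ∼ z)) →
      transpose p q Preserves _∼_ ⟶ _∼_
    transpose-preserves {p} {q} interchangeable {x} {y} x∼y
      with transposeView p q x | transposeView p q y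
    ... | first refl τx | first refl τy = along τx τy ∼-refl
    ... | first refl τx | second refl τy = along τx τy (∼-sym x∼y)
    ... | first refl τx | other y≢p y≢q τy = along τx τy (proj₁ (interchangeable y≢p y≢q) x∼y)
    ... | second refl τx | first refl τy = along τx τy (∼-sym x∼y)
    ... | second refl τx | second refl τy = along τx τy ∼-refl
    ... | second refl τx | other y≢p y≢q τy = along τx τy (proj₂ (interchangeable y≢p y≢q) x∼y)
    ... | other x≢p x≢q τx | first refl τy =
          along τx τy (∼-sym (proj₁ (interchangeable x≢p x≢q) (∼-sym x∼y)))
    ... | other x≢p x≢q τx | second refl τy =
          along τx τy (∼-sym (proj₂ (interchangeable x≢p x≢q) (∼-sym x∼y)))
    ... | other _ _ τx | other _ _ τy = along τx τy x∼y

open Transposition _≟_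

SameBlock : Partition → Atom → Atom → Set₁
SameBlock P x y = Σ Subset λ B → Block P B × B x × B y

_·_≈P_ : Perm → Partition → Partition → Set₁
π · P ≈P Q = ∀ C → (Block Q C → Block P (C ∘ to π)) × (Block P (C ∘ to π) → Block Q C)

·-≈P-unique : ∀ {π P Q Q′} → π · P ≈P Q → π · P ≈P Q′ → Q ≈P Q′
·-≈P-unique πP≈Q πP≈Q′ C =
  proj₂ (πP≈Q′ C) ∘ proj₁ (πP≈Q C) , proj₂ (πP≈Q C) ∘ proj₁ (πP≈Q′ C)

module _ (P : Partition) where

  private
    _∼_ = SameBlock P

  ∈-block-closed : ∀ {B x y} → Block P B → B x → x ∼ y → B y
  ∈-block-closed {B} {x} {y} bB Bx (C , bC , Cx , Cy) =
    proj₁ (disjoint P C B bC bB x Cx Bx y) Cy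

  sameBlock-isEquivalence : IsEquivalence _∼_
  sameBlock-isEquivalence = record
    { refl  = λ {x} → let (B , bB , Bx) = cover P x in B , bB , Bx , Bx
    ; sym   = λ (B , bB , Bx , By) → B , bB , By , Bx
    ; trans = λ (B , bB , Bx , By) y∼z → B , bB , Bx , ∈-block-closed bB By y∼z
    }

  block-ext-≗ : ∀ {B C} → (∀ a → B a ≡ C a) → Block P B → Block P C
  block-ext-≗ B≗C = block-ext P λ a → subst id (B≗C a) , subst id (sym (B≗C a))

  ·-invariant⇒to-preserves : ∀ π → π · P ≈P P → to π Preserves _∼_ ⟶ _∼_
  ·-invariant⇒to-preserves π invariant {x} {y} (B , bB , Bx , By) =
    B ∘ from π ,
    proj₂ (invariant (B ∘ from π)) (block-ext-≗ (λ a → cong B (sym (strictlyInverseʳ π a))) bB) ,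
    subst B (sym (strictlyInverseʳ π x)) Bx ,
    subst B (sym (strictlyInverseʳ π y)) By

  ·-invariant⇒from-preserves : ∀ π → π · P ≈P P → from π Preserves _∼_ ⟶ _∼_
  ·-invariant⇒from-preserves π invariant {x} {y} (B , bB , Bx , By) =
    B ∘ to π ,
    proj₁ (invariant B) bB ,
    subst B (sym (strictlyInverseˡ π x)) Bx ,
    subst B (sym (strictlyInverseˡ π y)) By

  module _ (π : Perm) (to-preserves : to π Preserves _∼_ ⟶ _∼_)
                      (from-preserves : from π Preserves _∼_ ⟶ _∼_) where

    -- The preimage of C is the block of π⁻¹ a, for any a ∈ C.
    block-preimage : ∀ {C} → Block P C → Block P (C ∘ to π)
    block-preimage {C} bC with nonempty P C bC
    ... | a , Ca with cover P (from π a)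
    ...   | B , bB , Ba′ = block-ext P B≐C∘π bB
      where
      B≐C∘π : B ≐ (C ∘ to π)
      B≐C∘π y =
        (λ By → ∈-block-closed bC Ca
                  (subst (_∼ to π y) (strictlyInverseˡ π a) (to-preserves (B , bB , Ba′ , By)))) ,
        (λ Cπy → subst B (strictlyInverseʳ π y)
                  (∈-block-closed bB Ba′ (from-preserves (C , bC , Ca , Cπy))))

  preserves⇒·-invariant : ∀ π → to π Preserves _∼_ ⟶ _∼_ → from π Preserves _∼_ ⟶ _∼_ →
                          π · P ≈P P
  preserves⇒·-invariant π to-preserves from-preserves C =
    block-preimage π to-preserves from-preserves ,
    block-ext-≗ (cong C ∘ strictlyInverseˡ π) ∘ block-preimage (↔-sym π) from-preserves to-preserves

perm-injective : ∀ (π : Perm) {x y} → to π x ≡ to π y → x ≡ y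
perm-injective π = Injection.injective (↔⇒↣ π)

_•_ : ∀ {n} → Perm → Cycle n → Cycle n
π • c = record
  { σ       = to π ∘ σ c ∘ from π
  ; pts     = to π ∘ pts c
  ; pts-inj = λ i j i<n j<n πpᵢ≡πpⱼ → pts-inj c i j i<n j<n (perm-injective π πpᵢ≡πpⱼ)
  ; step    = λ i i+1<n → cong (to π) (trans (cong (σ c) (strictlyInverseʳ π _)) (step c i i+1<n))
  ; wrap    = cong (to π) (trans (cong (σ c) (strictlyInverseʳ π _)) (wrap c))
  ; fixed   = λ a off → trans (cong (to π) (fixed c (from π a) (off-cycle a off)))
                              (strictlyInverseˡ π a)
  }
  where
  off-cycle : ∀ a → (∀ i → i < _ → ¬ to π (pts c i) ≡ a) → ∀ i → i < _ → ¬ pts c i ≡ from π a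
  off-cycle a off i i<n pᵢ≡π⁻¹a =
    off i i<n (trans (cong (to π) pᵢ≡π⁻¹a) (strictlyInverseˡ π a))

-- Evaluating at q gives σ q = (p q) (σ p), forcing either σ (σ p) = p or σ q = σ p.
cycle≉transposition-conjugate :
  ∀ {n} (c : Cycle n) → 2 < n → (∀ {x y} → σ c x ≡ σ c y → x ≡ y) →
  ∀ {q} → q ≢ pts c 0 → ¬ c ≈C (transposition (pts c 0) q • c)
cycle≉transposition-conjugate c 2<n σ-injective {q} q≢p c≈τcτ = impossible (transposeView p q p₁)
  where
  open ≡-Reasoning
  p p₁ : Atom
  p = pts c 0
  p₁ = pts c 1
  τ : Atom → Atom
  τ = transpose p q
  1<n : 1 < _
  1<n = <⇒≤ 2<n
  0<n : 0 < _
  0<n = <⇒≤ 1<n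

  σp≡p₁ : σ c p ≡ p₁
  σp≡p₁ = step c 0 1<n

  σq≡τp₁ : σ c q ≡ τ p₁
  σq≡τp₁ = begin
    σ c q           ≡⟨ c≈τcτ q ⟩
    τ (σ c (τ q))   ≡⟨ cong (τ ∘ σ c) (transpose-second p q) ⟩
    τ (σ c p)       ≡⟨ cong τ σp≡p₁ ⟩
    τ p₁            ∎

  impossible : TransposeView p q p₁ → ⊥
  impossible (first p₁≡p _) = contradiction (pts-inj c 1 0 1<n 0<n p₁≡p) λ ()
  impossible (second p₁≡q τp₁) = contradiction (pts-inj c 2 0 2<n 0<n p₂≡p) λ ()
    where
    p₂≡p : pts c 2 ≡ p
    p₂≡p = begin
      pts c 2   ≡⟨ step c 1 2<n ⟨
      σ c p₁    ≡⟨ cong (σ c) p₁≡q ⟩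
      σ c q     ≡⟨ σq≡τp₁ ⟩
      τ p₁      ≡⟨ τp₁ ⟩
      p         ∎
  impossible (other _ _ τp₁) = q≢p (σ-injective (trans σq≡τp₁ (trans τp₁ (sym σp≡p₁))))

module _ {n} (2<n : 2 < n)
         (f : Cycle n → Partition) (f-injective : Injective f) (supp : FinitelySupported f)
         (c : Cycle n) (ρ : Perm) (ρ≗σ : ∀ a → to ρ a ≡ σ c a) (ρ-fixes : Fixes ρ (proj₁ supp))
         where

  private
    E : List Atom
    E = proj₁ supp
    P : Partition
    P = f c
    _∼_ : Atom → Atom → Set₁
    _∼_ = SameBlock P
    open IsEquivalence (sameBlock-isEquivalence P)
      renaming (refl to ∼-refl; sym to ∼-sym; trans to ∼-trans)

    p p₁ : Atom
    p = pts c 0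
    p₁ = pts c 1
    1<n : 1 < n
    1<n = <⇒≤ 2<n
    0<n : 0 < n
    0<n = <⇒≤ 1<n

    σp≡p₁ : σ c p ≡ p₁
    σp≡p₁ = step c 0 1<n

    p₁≢p : p₁ ≢ p
    p₁≢p p₁≡p = contradiction (pts-inj c 1 0 1<n 0<n p₁≡p) λ ()

    moved⇒∉E : ∀ {a} → σ c a ≢ a → a ∉ E
    moved⇒∉E σa≢a a∈E = σa≢a (trans (sym (ρ≗σ _)) (ρ-fixes _ a∈E))

    p∉E : p ∉ E
    p∉E = moved⇒∉E (λ σp≡p → p₁≢p (trans (sym σp≡p₁) σp≡p))

    p₁∉E : p₁ ∉ E
    p₁∉E = moved⇒∉E λ σp₁≡p₁ →
      contradiction (pts-inj c 2 1 2<n 1<n (trans (sym (step c 1 2<n)) σp₁≡p₁)) λ ()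

    equivariant : ∀ π → Fixes π E → π · P ≈P f (π • c)
    equivariant π π-fixes = proj₂ supp π π-fixes c (π • c) λ _ → refl

    P-invariant : ρ · P ≈P P
    P-invariant = proj₂ supp ρ ρ-fixes c c λ a → begin
      σ c a                    ≡⟨ ρ≗σ a ⟨
      to ρ a                   ≡⟨ cong (to ρ) (strictlyInverseˡ ρ a) ⟨
      to ρ (to ρ (from ρ a))   ≡⟨ cong (to ρ) (ρ≗σ _) ⟩
      to ρ (σ c (from ρ a))    ∎
      where open ≡-Reasoning

    σ-preserves : σ c Preserves _∼_ ⟶ _∼_
    σ-preserves x∼y = subst₂ _∼_ (ρ≗σ _) (ρ≗σ _) (·-invariant⇒to-preserves P ρ P-invariant x∼y)

    σ⁻¹-preserves : from ρ Preserves _∼_ ⟶ _∼_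
    σ⁻¹-preserves = ·-invariant⇒from-preserves P ρ P-invariant

    σ-injective : ∀ {x y} → σ c x ≡ σ c y → x ≡ y
    σ-injective {x} {y} σx≡σy = perm-injective ρ (trans (ρ≗σ x) (trans σx≡σy (sym (ρ≗σ y))))

    Interchangeable : Atom → Set₁
    Interchangeable q = ∀ {z} → z ≢ p → z ≢ q → (p ∼ z → q ∼ z) × (q ∼ z → p ∼ z)

    not-interchangeable : ∀ {q} → q ≢ p → q ∉ E → ¬ Interchangeable q
    not-interchangeable {q} q≢p q∉E interchangeable =
      cycle≉transposition-conjugate c 2<n σ-injective q≢p
        (f-injective c (τ • c) P≈f[τc])
      where
      τ : Perm
      τ = transposition p q
      τ-preserves : transpose p q Preserves _∼_ ⟶ _∼_
      τ-preserves = transpose-preserves (sameBlock-isEquivalence P) interchangeable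
      τP≈P : τ · P ≈P P
      τP≈P = preserves⇒·-invariant P τ τ-preserves τ-preserves
      τ-fixes : Fixes τ E
      τ-fixes e e∈E = transpose-other (λ { refl → p∉E e∈E }) (λ { refl → q∉E e∈E })
      P≈f[τc] : P ≈P f (τ • c)
      P≈f[τc] = ·-≈P-unique {τ} {P} {P} {f (τ • c)} τP≈P (equivariant τ τ-fixes)

    RelatedOutsideE : Set₁
    RelatedOutsideE = Σ Atom λ q → q ≢ p × q ∉ E × p ∼ q

    ¬relatedOutsideE : ¬ RelatedOutsideE
    ¬relatedOutsideE (q , q≢p , q∉E , p∼q) =
      not-interchangeable q≢p q∉E λ _ _ → ∼-trans (∼-sym p∼q) , ∼-trans p∼q

    -- For z ∈ E, p ∼ z gives σ p ∼ σ z = z, so σ p ∼ p.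
    p-isolated : ∀ {z} → z ≢ p → ¬ p ∼ z
    p-isolated {z} z≢p p∼z with z ∈? E
    ... | no z∉E = ¬relatedOutsideE (z , z≢p , z∉E , p∼z)
    ... | yes z∈E = ¬relatedOutsideE (p₁ , p₁≢p , p₁∉E , ∼-trans p∼z (∼-sym p₁∼z))
      where
      p₁∼z : p₁ ∼ z
      p₁∼z = subst₂ _∼_ σp≡p₁ (trans (sym (ρ≗σ z)) (ρ-fixes z z∈E)) (σ-preserves p∼z)

    p₁-isolated : ∀ {z} → z ≢ p₁ → ¬ p₁ ∼ z
    p₁-isolated {z} z≢p₁ p₁∼z =
      p-isolated σ⁻¹z≢p (subst (_∼ from ρ z) σ⁻¹p₁≡p (σ⁻¹-preserves p₁∼z))
      where
      σ⁻¹p₁≡p : from ρ p₁ ≡ p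
      σ⁻¹p₁≡p = trans (cong (from ρ) (trans (sym σp≡p₁) (sym (ρ≗σ p)))) (strictlyInverseʳ ρ p)
      σ⁻¹z≢p : from ρ z ≢ p
      σ⁻¹z≢p σ⁻¹z≡p = z≢p₁ (trans (sym (strictlyInverseˡ ρ z))
                                  (trans (cong (to ρ) σ⁻¹z≡p) (trans (ρ≗σ p) σp≡p₁)))

  no-injection-with-cycle-fixing-support : ⊥
  no-injection-with-cycle-fixing-support =
    not-interchangeable p₁≢p p₁∉E λ z≢p z≢p₁ →
      ⊥-elim ∘ p-isolated z≢p , ⊥-elim ∘ p₁-isolated z≢p₁

rotation : ℕ → ℕ → Perm
rotation m zero    = ↔-id ℕ
rotation m (suc L) = rotation m L ↔-∘ transposition (m + L) (m + suc L)

rotation-fixes-above : ∀ m L {a} → m + L < a → to (rotation m L) a ≡ a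
rotation-fixes-above m zero    _      = refl
rotation-fixes-above m (suc L) {a} m+1+L<a =
  trans (cong (to (rotation m L)) (transpose-other a≢m+L a≢m+1+L)) (rotation-fixes-above m L m+L<a)
  where
  m+L<a : m + L < a
  m+L<a = <-trans (+-monoʳ-< m (n<1+n L)) m+1+L<a
  a≢m+L : a ≢ m + L
  a≢m+L = ≢-sym (<⇒≢ m+L<a)
  a≢m+1+L : a ≢ m + suc L
  a≢m+1+L = ≢-sym (<⇒≢ m+1+L<a)

rotation-fixes-below : ∀ m L {a} → a < m → to (rotation m L) a ≡ a
rotation-fixes-below m zero    _   = refl
rotation-fixes-below m (suc L) {a} a<m =
  trans (cong (to (rotation m L)) (transpose-other (a≢m+ L) (a≢m+ (suc L))))
        (rotation-fixes-below m L a<m)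
  where
  a≢m+ : ∀ i → a ≢ m + i
  a≢m+ i = <⇒≢ (<-≤-trans a<m (m≤m+n m i))

rotation-last : ∀ m L → to (rotation m L) (m + L) ≡ m + 0
rotation-last m zero    = refl
rotation-last m (suc L) =
  trans (cong (to (rotation m L)) (transpose-second (m + L) (m + suc L))) (rotation-last m L)

rotation-step : ∀ m L {i} → i < L → to (rotation m L) (m + i) ≡ m + suc i
rotation-step m (suc L) {i} i<1+L with m≤n⇒m<n∨m≡n (s≤s⁻¹ i<1+L)
... | inj₁ i<L =
  trans (cong (to (rotation m L)) (transpose-other m+i≢m+L m+i≢m+1+L)) (rotation-step m L i<L)
  where
  m+i≢m+L : m + i ≢ m + L
  m+i≢m+L = <⇒≢ (+-monoʳ-< m i<L)
  m+i≢m+1+L : m + i ≢ m + suc L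
  m+i≢m+1+L = <⇒≢ (+-monoʳ-< m i<1+L)
... | inj₂ refl =
  trans (cong (to (rotation m L)) (transpose-first (m + L) (m + suc L)))
        (rotation-fixes-above m L (+-monoʳ-< m (n<1+n L)))

rotation-fixes-off-cycle : ∀ m L a → (∀ i → i < suc L → m + i ≢ a) → to (rotation m L) a ≡ a
rotation-fixes-off-cycle m L a off with m ≤? a
... | no m≰a = rotation-fixes-below m L (≰⇒> m≰a)
... | yes m≤a with a ∸ m ≤? L
...   | yes a-m≤L = contradiction (m+[n∸m]≡n m≤a) (off (a ∸ m) (s≤s a-m≤L))
...   | no a-m≰L =
  rotation-fixes-above m L (subst (m + L <_) (m+[n∸m]≡n m≤a) (+-monoʳ-< m (≰⇒> a-m≰L)))

rotationCycle : ℕ → (L : ℕ) → Cycle (suc L)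
rotationCycle m L = record
  { σ       = to (rotation m L)
  ; pts     = m +_
  ; pts-inj = λ i j _ _ → +-cancelˡ-≡ m i j
  ; step    = λ i i+1<1+L → rotation-step m L (s≤s⁻¹ i+1<1+L)
  ; wrap    = rotation-last m L
  ; fixed   = rotation-fixes-off-cycle m L
  }

theorem3p1 : ∀ (n : ℕ) → 3 ≤ n → ¬ InjectionInModel n
theorem3p1 zero ()
theorem3p1 (suc L) 3≤n (f , _ , f-injective , supp@(E , _)) =
  no-injection-with-cycle-fixing-support 3≤n f f-injective supp
    (rotationCycle m L) (rotation m L) (λ _ → refl)
    (λ e e∈E → rotation-fixes-below m L (s≤s (All.lookup (xs≤max 0 E) e∈E)))
  where
  m : ℕ
  m = suc (max 0 E)
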